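{- There exist infinitely many triples $\{a,b,c\}$ of distinct nonzero rational numbers such that each of the seven numbers \[ a+1,\quad b+1,\quad c+1,\quad ab+1,\quad ac+1,\quad bc+1,\quad abc+1 \] is the square of a rational number.
   Context: A rational number is called a perfect square if it is the square of a rational number. -}

module Defs where

open import Data.Rational using (ℚ; _+_; _*_; 1ℚ; 0ℚ)
open import Data.Product using (_×_; ∃; Σ-syntax; ∃-syntax)
open import Data.List using (List; _∷_; [])
open import Data.List.Membership.Propositional using (_∈_)
open import Data.List.Relation.Unary.All using (All)
open import Relation.Binary.PropositionalEquality using (_≡_)
open import Relation.Nullary using (¬_)

IsSquare : ℚ → Set
IsSquare q = ∃[ r ] (r * r ≡ q)

GoodTriple : ℚ → ℚ → ℚ → Set
GoodTriple a b c =
  ¬ (a ≡ b) × ¬ (a ≡ c) × ¬ (b ≡ c) ×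
  ¬ (a ≡ 0ℚ) × ¬ (b ≡ 0ℚ) × ¬ (c ≡ 0ℚ) ×
  IsSquare (a + 1ℚ) × IsSquare (b + 1ℚ) × IsSquare (c + 1ℚ) ×
  IsSquare (a * b + 1ℚ) × IsSquare (a * c + 1ℚ) × IsSquare (b * c + 1ℚ) ×
  IsSquare (a * b * c + 1ℚ)

Triple : Set
Triple = ℚ × ℚ × ℚ

elems : Triple → List ℚ
elems (a Data.Product., b Data.Product., c) = a ∷ b ∷ c ∷ []

-- two triples denote the same set {a,b,c}
SameSet : Triple → Triple → Set
SameSet t u = All (_∈ elems u) (elems t) × All (_∈ elems t) (elems u)

-- If (x, y) lies on the quartic 3x²y² − 2xy − 4x² − 4y² + 7 = 0, i.e. (x² − 1)(y² − 1) + 1 = r²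
-- with r = (xy + 1)/2, then a = x² − 1, b = y² − 1 and c = w² − 1 with w = (xy − 1)/2 satisfy all
-- seven conditions: ac + 1, bc + 1 and abc + 1 are the squares of xw − y, yw − x and w² + w − 1.
-- The quartic is the image of the elliptic curve y² = x³ + 18x² − 3x under an explicit rational
-- map. Doubling a suitable point k times gives a point whose Z-coordinate is 2^(k+2) times an odd
-- number, and then a, b, c have 2-adic valuations k + 4, 3 and 0. Hence a, b, c are distinct and
-- nonzero, and the numerator of a is at least 2^(k+4) > k: once k exceeds every numerator occurring
-- in a given finite list of triples, {a, b, c} is not among them.
module Submission where

open import Defs
open import Data.Rational using (ℚ)
open import Data.Product using (_×_; _,_; ∃-syntax; proj₁; proj₂)
open import Data.List using (List; _∷_; [])
open import Data.List.Relation.Unary.All using (All)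
open import Relation.Nullary using (¬_)

open import Agda.Builtin.FromNat using (Number; fromNat)
open import Data.Integer using (ℤ)
open import Data.Nat using (ℕ)
open import Data.Unit using (tt)
open import Function using (_∘_)
open import Level using (0ℓ)
open import Relation.Binary.PropositionalEquality
open import Relation.Nullary.Decidable using (dec⇒maybe)
import Data.Nat.Literals as ℕ
import Data.Integer.Literals as ℤ
import Data.Rational.Literals as ℚ
import Data.Rational as ℚ
import Data.Rational.Properties as ℚ
import Tactic.RingSolver as RingSolver
import Tactic.RingSolver.Core.AlmostCommutativeRing as ACR

instance
  ℕ-number : Number ℕ
  ℕ-number = ℕ.number
  ℤ-number : Number ℤ
  ℤ-number = ℤ.number
  ℚ-number : Number ℚ
  ℚ-number = ℚ.number

ℚ-ring : ACR.AlmostCommutativeRing 0ℓ 0ℓ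
ℚ-ring = ACR.fromCommutativeRing ℚ.+-*-commutativeRing (dec⇒maybe ∘ (ℚ.0ℚ ℚ.≟_))

module Parity where

  open import Data.Integer
  open import Data.Integer.Properties using (abs-*)
  open import Data.Integer.Tactic.RingSolver using (solve)
  import Data.Nat as ℕ
  import Data.Nat.Properties as ℕ
  open import Data.Sum using (_⊎_; inj₁; inj₂; [_,_]′)

  Even Odd : ℤ → Set
  Even n = ∃[ t ] n ≡ 2 * t
  Odd  n = ∃[ t ] n ≡ 1 + 2 * t

  variable m n : ℤ

  odd*odd : Odd m → Odd n → Odd (m * n)
  odd*odd (s , refl) (t , refl) = s + t + 2 * s * t , solve (s ∷ t ∷ [])

  even* : Even m → ∀ n → Even (m * n)
  even* (s , refl) n = s * n , solve (s ∷ n ∷ [])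

  *even : ∀ m → Even n → Even (m * n)
  *even m (t , refl) = m * t , solve (m ∷ t ∷ [])

  odd+even : Odd m → Even n → Odd (m + n)
  odd+even (s , refl) (t , refl) = s + t , solve (s ∷ t ∷ [])

  even+odd : Even m → Odd n → Odd (m + n)
  even+odd (s , refl) (t , refl) = s + t , solve (s ∷ t ∷ [])

  odd+odd : Odd m → Odd n → Even (m + n)
  odd+odd (s , refl) (t , refl) = 1 + s + t , solve (s ∷ t ∷ [])

  odd-even : Odd m → Even n → Odd (m - n)
  odd-even (s , refl) (t , refl) = s - t , solve (s ∷ t ∷ [])

  even-odd : Even m → Odd n → Odd (m - n)
  even-odd (s , refl) (t , refl) = s - t - 1 , solve (s ∷ t ∷ [])

  -even : Even n → Even (- n)
  -even (t , refl) = - t , solve (t ∷ [])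

  -odd : Odd n → Odd (- n)
  -odd (t , refl) = - t - 1 , solve (t ∷ [])

  even≢odd : Even m → Odd n → m ≢ n
  even≢odd (s , refl) (t , refl) eq =
    ℕ.even≢odd ∣ s - t ∣ 0 (trans (sym (abs-* 2 (s - t))) (cong ∣_∣ 2[s-t]≡1))
    where
    open ≡-Reasoning
    2[s-t]≡1 : 2 * (s - t) ≡ 1
    2[s-t]≡1 = begin
      2 * (s - t)       ≡⟨ solve (s ∷ t ∷ []) ⟩
      2 * s - 2 * t     ≡⟨ cong (_- 2 * t) eq ⟩
      1 + 2 * t - 2 * t ≡⟨ solve (t ∷ []) ⟩
      1                 ∎

  odd≢0 : Odd n → n ≢ 0
  odd≢0 n-odd n≡0 = even≢odd (0 , refl) n-odd (sym n≡0)

  parity : ∀ n → Even n ⊎ Odd n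
  parity (+ n)    = parity⁺ n
    where
    parity⁺ : ∀ n → Even (+ n) ⊎ Odd (+ n)
    parity⁺ ℕ.zero    = inj₁ (0 , refl)
    parity⁺ (ℕ.suc n) = [ inj₂ ∘ odd+even (0 , refl) , inj₁ ∘ odd+odd (0 , refl) ]′ (parity⁺ n)
  parity -[1+ n ] = [ inj₁ ∘ -even , inj₂ ∘ -odd ]′ (parity (+ ℕ.suc n))

module PowersOfTwo where

  open import Data.Integer
  open import Data.Integer.Properties
  open import Data.Integer.Tactic.RingSolver using (solve-∀)
  import Data.Nat as ℕ
  open import Data.Sum using (inj₁; inj₂)
  open import Relation.Nullary using (contradiction)
  open Parity

  2^suc*-even : ∀ j n → Even (2 ^ ℕ.suc j * n)
  2^suc*-even j n = even* (even* (1 , refl) (2 ^ j)) n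

  2^j≢0 : ∀ j → 2 ^ j ≢ 0
  2^j≢0 ℕ.zero    ()
  2^j≢0 (ℕ.suc j) eq with i*j≡0⇒i≡0∨j≡0 2 eq
  ... | inj₂ 2^j≡0 = 2^j≢0 j 2^j≡0

  ∣2^j∣ : ∀ j → ∣ 2 ^ j ∣ ≡ 2 ℕ.^ j
  ∣2^j∣ ℕ.zero    = refl
  ∣2^j∣ (ℕ.suc j) = trans (abs-* 2 (2 ^ j)) (cong (2 ℕ.*_) (∣2^j∣ j))

  2^j*odd≢0 : ∀ j → Odd n → 2 ^ j * n ≢ 0
  2^j*odd≢0 j n-odd eq with i*j≡0⇒i≡0∨j≡0 (2 ^ j) eq
  ... | inj₁ 2^j≡0 = 2^j≢0 j 2^j≡0
  ... | inj₂ n≡0   = odd≢0 n-odd n≡0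

  2^∣n*odd⇒2^∣n : ∀ j {m n d} → Odd d → 2 ^ j * m ≡ n * d → ∃[ n′ ] n ≡ 2 ^ j * n′
  2^∣n*odd⇒2^∣n ℕ.zero    {n = n} _ _ = n , sym (*-identityˡ n)
  2^∣n*odd⇒2^∣n (ℕ.suc j) {m} {n} {d} d-odd eq with parity n
  ... | inj₂ n-odd = contradiction eq (even≢odd (2^suc*-even j m) (odd*odd n-odd d-odd))
  ... | inj₁ (t , refl) with 2^∣n*odd⇒2^∣n j {n = t} d-odd (*-cancelˡ-≡ 2 _ _ (begin
      2 * (2 ^ j * m) ≡⟨ *-assoc 2 (2 ^ j) m ⟨
      2 * 2 ^ j * m   ≡⟨ eq ⟩
      2 * t * d       ≡⟨ *-assoc 2 t d ⟩
      2 * (t * d)     ∎))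
    where open ≡-Reasoning
  ... | t′ , refl = t′ , sym (*-assoc 2 (2 ^ j) t′)

  record Val₂ℤ (n : ℤ) (j : ℕ) : Set where
    constructor val₂ℤ
    field
      {u}   : ℤ
      u-odd : Odd u
      n≡    : n ≡ 2 ^ j * u

  odd⇒Val₂ℤ0 : Odd n → Val₂ℤ n 0
  odd⇒Val₂ℤ0 {n} n-odd = val₂ℤ n-odd (sym (*-identityˡ n))

  Val₂ℤ-*-sub : ∀ {n d m e i} → Val₂ℤ (n - d) (3 ℕ.+ i) → Val₂ℤ (m - e) 2 → Odd d →
    Val₂ℤ (n * m - d * e) 2
  Val₂ℤ-*-sub {n} {d} {m} {e} {i} (val₂ℤ {α} α-odd n-d≡) (val₂ℤ {γ} γ-odd m-e≡) d-odd =
    val₂ℤ (even+odd (even* (2^suc*-even i α) m) (odd*odd d-odd γ-odd)) (begin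
      n * m - d * e                           ≡⟨ split n m d e ⟩
      (n - d) * m + d * (m - e)               ≡⟨ cong₂ (λ p q → p * m + d * q) n-d≡ m-e≡ ⟩
      2 ^ (3 ℕ.+ i) * α * m + d * (2 ^ 2 * γ) ≡⟨ regroup (2 ^ (1 ℕ.+ i)) α m d γ ⟩
      2 ^ 2 * (2 ^ (1 ℕ.+ i) * α * m + d * γ) ∎)
    where
    open ≡-Reasoning
    split : ∀ n m d e → n * m - d * e ≡ (n - d) * m + d * (m - e)
    split = solve-∀
    regroup : ∀ p α m d γ → 2 * (2 * p) * α * m + d * (4 * γ) ≡ 4 * (p * α * m + d * γ)
    regroup = solve-∀

module SevenSquares where

  open import Data.Rational using (_+_; _*_; _-_; ½; 0ℚ; 1ℚ)
  open import Data.Rational.Properties using (*-zeroʳ; +-identityʳ; +-inverseʳ)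

  SevenSquares : ℚ → ℚ → ℚ → Set
  SevenSquares a b c =
    IsSquare (a + 1ℚ) × IsSquare (b + 1ℚ) × IsSquare (c + 1ℚ) ×
    IsSquare (a * b + 1ℚ) × IsSquare (a * c + 1ℚ) × IsSquare (b * c + 1ℚ) ×
    IsSquare (a * b * c + 1ℚ)

  half-sum half-diff : ℚ → ℚ → ℚ
  half-sum  x y = ½ * (x * y + 1ℚ)
  half-diff x y = ½ * (x * y - 1ℚ)

  -- Equivalently 3x²y² − 2xy − 4x² − 4y² + 7 = 0.
  OnQuartic : ℚ → ℚ → Set
  OnQuartic x y = (x * x - 1ℚ) * (y * y - 1ℚ) + 1ℚ ≡ half-sum x y * half-sum x y

  square-modulo : ∀ s k {t δ} → s * s ≡ t - k * δ → δ ≡ 0ℚ → IsSquare t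
  square-modulo s k {t} eq refl = s , trans eq (trans (cong (t -_) (*-zeroʳ k)) (+-identityʳ t))

  square≡square-1+1 : ∀ t → t * t ≡ t * t - 1ℚ + 1ℚ
  square≡square-1+1 = RingSolver.solve-∀ ℚ-ring

  ac+1-identity : ∀ x y →
    let a = x * x - 1ℚ; b = y * y - 1ℚ; r = ½ * (x * y + 1ℚ); w = ½ * (x * y - 1ℚ); c = w * w - 1ℚ
    in (x * w - y) * (x * w - y) ≡ a * c + 1ℚ - 1ℚ * (a * b + 1ℚ - r * r)
  ac+1-identity = RingSolver.solve-∀ ℚ-ring

  bc+1-identity : ∀ x y →
    let a = x * x - 1ℚ; b = y * y - 1ℚ; r = ½ * (x * y + 1ℚ); w = ½ * (x * y - 1ℚ); c = w * w - 1ℚ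
    in (y * w - x) * (y * w - x) ≡ b * c + 1ℚ - 1ℚ * (a * b + 1ℚ - r * r)
  bc+1-identity = RingSolver.solve-∀ ℚ-ring

  abc+1-identity : ∀ x y →
    let a = x * x - 1ℚ; b = y * y - 1ℚ; r = ½ * (x * y + 1ℚ); w = ½ * (x * y - 1ℚ); c = w * w - 1ℚ
    in (w * w + w - 1ℚ) * (w * w + w - 1ℚ) ≡ a * b * c + 1ℚ - c * (a * b + 1ℚ - r * r)
  abc+1-identity = RingSolver.solve-∀ ℚ-ring

  seven-squares : ∀ x y → OnQuartic x y →
    SevenSquares (x * x - 1ℚ) (y * y - 1ℚ) (half-diff x y * half-diff x y - 1ℚ)
  seven-squares x y on-quartic =
    (x , square≡square-1+1 x) , (y , square≡square-1+1 y) , (w , square≡square-1+1 w) ,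
    (half-sum x y , sym on-quartic) ,
    square-modulo (x * w - y) 1ℚ (ac+1-identity x y) δ≡0 ,
    square-modulo (y * w - x) 1ℚ (bc+1-identity x y) δ≡0 ,
    square-modulo (w * w + w - 1ℚ) (w * w - 1ℚ) (abc+1-identity x y) δ≡0
    where
    w : ℚ
    w = half-diff x y
    δ≡0 : (x * x - 1ℚ) * (y * y - 1ℚ) + 1ℚ - half-sum x y * half-sum x y ≡ 0ℚ
    δ≡0 = trans (cong (_- half-sum x y * half-sum x y) on-quartic)
                (+-inverseʳ (half-sum x y * half-sum x y))

module Fractions where

  open import Data.Integer as ℤ using (ℤ; 0ℤ)
  import Data.Integer.Properties as ℤ
  import Data.Integer.Tactic.RingSolver as ℤ
  open import Data.Rational
  open import Data.Rational.Literals using (fromℤ) public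
  open import Data.Rational.Properties
  import Data.Rational.Unnormalised as ℚᵘ
  import Data.Rational.Unnormalised.Properties as ℚᵘ
  open SevenSquares using (half-diff)

  fromℤ-+ : ∀ m n → fromℤ (m ℤ.+ n) ≡ fromℤ m + fromℤ n
  fromℤ-+ m n = toℚᵘ-injective (ℚᵘ.≃-trans (ℚᵘ.*≡* (identity m n))
    (ℚᵘ.≃-sym (toℚᵘ-homo-+ (fromℤ m) (fromℤ n))))
    where
    identity : ∀ m n → (m ℤ.+ n) ℤ.* 1 ≡ (m ℤ.* 1 ℤ.+ n ℤ.* 1) ℤ.* 1
    identity = ℤ.solve-∀

  fromℤ-* : ∀ m n → fromℤ (m ℤ.* n) ≡ fromℤ m * fromℤ n
  fromℤ-* m n = toℚᵘ-injective (ℚᵘ.≃-sym (toℚᵘ-homo-* (fromℤ m) (fromℤ n)))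

  fromℤ-neg : ∀ n → fromℤ (ℤ.- n) ≡ - fromℤ n
  fromℤ-neg n = toℚᵘ-injective (ℚᵘ.≃-sym (toℚᵘ-homo‿- (fromℤ n)))

  fromℤ-- : ∀ m n → fromℤ (m ℤ.- n) ≡ fromℤ m - fromℤ n
  fromℤ-- m n = trans (fromℤ-+ m (ℤ.- n)) (cong (λ q → fromℤ m + q) (fromℤ-neg n))

  fromℤ-*-sub : ∀ a b c d → fromℤ (a ℤ.* b ℤ.- c ℤ.* d) ≡ fromℤ a * fromℤ b - fromℤ c * fromℤ d
  fromℤ-*-sub a b c d = trans (fromℤ-- (a ℤ.* b) (c ℤ.* d)) (cong₂ _-_ (fromℤ-* a b) (fromℤ-* c d))

  fromℤ-injective : ∀ {m n} → fromℤ m ≡ fromℤ n → m ≡ n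
  fromℤ-injective = cong ↥_

  fromℤ-monomial : ∀ a b c d e →
    fromℤ (a ℤ.* b ℤ.* c ℤ.* d ℤ.* e) ≡ fromℤ a * fromℤ b * fromℤ c * fromℤ d * fromℤ e
  fromℤ-monomial a b c d e =
    trans (fromℤ-* (a ℤ.* b ℤ.* c ℤ.* d) e) (cong (_* fromℤ e)
      (trans (fromℤ-* (a ℤ.* b ℤ.* c) d) (cong (_* fromℤ d)
        (trans (fromℤ-* (a ℤ.* b) c) (cong (_* fromℤ c) (fromℤ-* a b))))))

  -- q = n / d without dividing; a record, so that q, n and d can be inferred from a proof.
  infix 4 _≐_÷_
  record _≐_÷_ (q : ℚ) (n d : ℤ) : Set where
    constructor cleared
    field
      clear : q * fromℤ d ≡ fromℤ n

  open _≐_÷_ public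

  ≐-↥÷↧ : ∀ q → q ≐ ↥ q ÷ ↧ q
  ≐-↥÷↧ q@record{} = cleared (toℚᵘ-injective (ℚᵘ.≃-trans (toℚᵘ-homo-* q (fromℤ (↧ q)))
    (ℚᵘ.*≡* (ℤ.*-assoc (↥ q) (↧ q) 1))))

  ≐-cross : ∀ {p q n m d e} → p ≐ n ÷ d → q ≐ m ÷ e → p ≡ q → n ℤ.* e ≡ m ℤ.* d
  ≐-cross {p} {q} {n} {m} {d} {e} (cleared p≐) (cleared q≐) refl = fromℤ-injective (begin
    fromℤ (n ℤ.* e)         ≡⟨ fromℤ-* n e ⟩
    fromℤ n * fromℤ e       ≡⟨ cong (_* fromℤ e) p≐ ⟨
    p * fromℤ d * fromℤ e   ≡⟨ swap p (fromℤ d) (fromℤ e) ⟩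
    p * fromℤ e * fromℤ d   ≡⟨ cong (_* fromℤ d) q≐ ⟩
    fromℤ m * fromℤ d       ≡⟨ fromℤ-* m d ⟨
    fromℤ (m ℤ.* d)         ∎)
    where
    open ≡-Reasoning
    swap : ∀ a b c → a * b * c ≡ a * c * b
    swap = RingSolver.solve-∀ ℚ-ring

  ≐-square-sub-one : ∀ {x n d} → x ≐ n ÷ d → x * x - 1ℚ ≐ (n ℤ.- d) ℤ.* (n ℤ.+ d) ÷ d ℤ.* d
  ≐-square-sub-one {x} {n} {d} (cleared x≐) = cleared (begin
    (x * x - 1ℚ) * fromℤ (d ℤ.* d)                  ≡⟨ cong ((x * x - 1ℚ) *_) (fromℤ-* d d) ⟩
    (x * x - 1ℚ) * (fromℤ d * fromℤ d)              ≡⟨ expand x (fromℤ d) ⟩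
    x * fromℤ d * (x * fromℤ d) - fromℤ d * fromℤ d ≡⟨ cong (λ t → t * t - fromℤ d * fromℤ d) x≐ ⟩
    fromℤ n * fromℤ n - fromℤ d * fromℤ d           ≡⟨ fromℤ-*-sub n n d d ⟨
    fromℤ (n ℤ.* n ℤ.- d ℤ.* d)                     ≡⟨ cong fromℤ (difference-of-squares n d) ⟩
    fromℤ ((n ℤ.- d) ℤ.* (n ℤ.+ d))                 ∎)
    where
    open ≡-Reasoning
    expand : ∀ x d → (x * x - 1ℚ) * (d * d) ≡ x * d * (x * d) - d * d
    expand = RingSolver.solve-∀ ℚ-ring
    difference-of-squares : ∀ n d → n ℤ.* n ℤ.- d ℤ.* d ≡ (n ℤ.- d) ℤ.* (n ℤ.+ d)
    difference-of-squares = ℤ.solve-∀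

  ∃-fraction : ∀ n {d} → d ≢ 0ℤ → ∃[ q ] q ≐ n ÷ d
  ∃-fraction n {d} d≢0 = fromℤ n * 1/ fromℤ d , cleared (begin
    fromℤ n * 1/ fromℤ d * fromℤ d   ≡⟨ *-assoc (fromℤ n) (1/ fromℤ d) (fromℤ d) ⟩
    fromℤ n * (1/ fromℤ d * fromℤ d) ≡⟨ cong (fromℤ n *_) (*-inverseˡ (fromℤ d)) ⟩
    fromℤ n * 1ℚ                     ≡⟨ *-identityʳ (fromℤ n) ⟩
    fromℤ n                          ∎)
    where
    open ≡-Reasoning
    instance _ = ≢-nonZero (d≢0 ∘ fromℤ-injective)

  ≐-half-diff : ∀ {x y n m d e t} → x ≐ n ÷ d → y ≐ m ÷ e → n ℤ.* m ℤ.- d ℤ.* e ≡ 2 ℤ.* t →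
    half-diff x y ≐ t ÷ d ℤ.* e
  ≐-half-diff {x} {y} {n} {m} {d} {e} {t} (cleared x≐) (cleared y≐) nm-de≡2t = cleared (begin
    half-diff x y * fromℤ (d ℤ.* e)                       ≡⟨ cong (half-diff x y *_) (fromℤ-* d e) ⟩
    half-diff x y * (fromℤ d * fromℤ e)                   ≡⟨ regroup x y (fromℤ d) (fromℤ e) ⟩
    ½ * (x * fromℤ d * (y * fromℤ e) - fromℤ d * fromℤ e)
      ≡⟨ cong₂ (λ p q → ½ * (p * q - fromℤ d * fromℤ e)) x≐ y≐ ⟩
    ½ * (fromℤ n * fromℤ m - fromℤ d * fromℤ e)           ≡⟨ cong (½ *_) (fromℤ-*-sub n m d e) ⟨
    ½ * fromℤ (n ℤ.* m ℤ.- d ℤ.* e)                       ≡⟨ cong (λ p → ½ * fromℤ p) nm-de≡2t ⟩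
    ½ * fromℤ (2 ℤ.* t)                                   ≡⟨ cong (½ *_) (fromℤ-* 2 t) ⟩
    ½ * (2 * fromℤ t)                                     ≡⟨ halve (fromℤ t) ⟩
    fromℤ t                                               ∎)
    where
    open ≡-Reasoning
    regroup : ∀ x y d e → ½ * (x * y - 1ℚ) * (d * e) ≡ ½ * (x * d * (y * e) - d * e)
    regroup = RingSolver.solve-∀ ℚ-ring
    halve : ∀ t → ½ * (2 * t) ≡ t
    halve = RingSolver.solve-∀ ℚ-ring

  *-cancelʳ-≡ : ∀ p q r → r ≢ 0ℚ → p * r ≡ q * r → p ≡ q
  *-cancelʳ-≡ p q r r≢0 eq = begin
    p              ≡⟨ *-identityʳ p ⟨
    p * 1ℚ         ≡⟨ cong (p *_) (*-inverseʳ r) ⟨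
    p * (r * 1/ r) ≡⟨ *-assoc p r (1/ r) ⟨
    p * r * 1/ r   ≡⟨ cong (_* 1/ r) eq ⟩
    q * r * 1/ r   ≡⟨ *-assoc q r (1/ r) ⟩
    q * (r * 1/ r) ≡⟨ cong (q *_) (*-inverseʳ r) ⟩
    q * 1ℚ         ≡⟨ *-identityʳ q ⟩
    q              ∎
    where
    open ≡-Reasoning
    instance _ = ≢-nonZero r≢0

module TwoAdicValuation where

  open import Data.Integer as ℤ using (ℤ; ∣_∣; _^_)
  import Data.Integer.Properties as ℤ
  import Data.Integer.Tactic.RingSolver as ℤ
  open import Data.Nat as ℕ using (_≤_)
  import Data.Nat.Properties as ℕ
  open import Data.Rational using (↥_; ↧_; 0ℚ; 1ℚ; _*_; _-_)
  open import Data.Rational.Properties using (*-zeroˡ; ↥p≡0⇒p≡0)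
  open Parity
  open PowersOfTwo
  open SevenSquares using (half-diff)
  open Fractions

  record Val₂ (q : ℚ) (j : ℕ) : Set where
    constructor val₂
    field
      {u d}    : ℤ
      u-odd    : Odd u
      d-odd    : Odd d
      fraction : q ≐ 2 ^ j ℤ.* u ÷ d

  Val₂⇒≢0 : ∀ {q j} → Val₂ q j → q ≢ 0ℚ
  Val₂⇒≢0 {j = j} (val₂ {d = d} u-odd _ (cleared q≐)) refl =
    2^j*odd≢0 j u-odd (fromℤ-injective (trans (sym q≐) (*-zeroˡ (fromℤ d))))

  Val₂⇒2^j≤∣↥∣ : ∀ {q j} → Val₂ q j → 2 ℕ.^ j ≤ ∣ ↥ q ∣
  Val₂⇒2^j≤∣↥∣ {q} {j} q-val@(val₂ {u} _ d-odd q≐)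
    with 2^∣n*odd⇒2^∣n j d-odd
           (trans (sym (ℤ.*-assoc (2 ^ j) u (↧ q))) (≐-cross q≐ (≐-↥÷↧ q) refl))
  ... | n′ , ↥q≡2^jn′ = begin
    2 ℕ.^ j              ≤⟨ ℕ.m≤m*n (2 ℕ.^ j) ∣ n′ ∣ ⟩
    2 ℕ.^ j ℕ.* ∣ n′ ∣   ≡⟨ cong (ℕ._* ∣ n′ ∣) (∣2^j∣ j) ⟨
    ∣ 2 ^ j ∣ ℕ.* ∣ n′ ∣ ≡⟨ ℤ.abs-* (2 ^ j) n′ ⟨
    ∣ 2 ^ j ℤ.* n′ ∣     ≡⟨ cong ∣_∣ ↥q≡2^jn′ ⟨
    ∣ ↥ q ∣              ∎
    where
    open ℕ.≤-Reasoning
    n′≢0 : n′ ≢ 0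
    n′≢0 refl = Val₂⇒≢0 q-val (↥p≡0⇒p≡0 q (trans ↥q≡2^jn′ (ℤ.*-zeroʳ (2 ^ j))))
    instance _ = ℕ.≢-nonZero (n′≢0 ∘ ℤ.∣i∣≡0⇒i≡0)

  Val₂-≢ : ∀ {p q i r} → Val₂ p i → Val₂ q (i ℕ.+ ℕ.suc r) → p ≢ q
  Val₂-≢ {i = i} {r} (val₂ {u} {d} u-odd _ p≐) (val₂ {v} {e} _ e-odd q≐) p≡q =
    even≢odd (2 ^ r ℤ.* v ℤ.* d , refl) (odd*odd u-odd e-odd) (sym ue≡2[2^rvd])
    where
    open ≡-Reasoning
    instance _ = ℤ.≢-nonZero (2^j≢0 i)
    regroup : ∀ a b v d → a ℤ.* (2 ℤ.* b) ℤ.* v ℤ.* d ≡ a ℤ.* (2 ℤ.* (b ℤ.* v ℤ.* d))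
    regroup = ℤ.solve-∀
    ue≡2[2^rvd] : u ℤ.* e ≡ 2 ℤ.* (2 ^ r ℤ.* v ℤ.* d)
    ue≡2[2^rvd] = ℤ.*-cancelˡ-≡ (2 ^ i) _ _ (begin
      2 ^ i ℤ.* (u ℤ.* e)                   ≡⟨ ℤ.*-assoc (2 ^ i) u e ⟨
      2 ^ i ℤ.* u ℤ.* e                     ≡⟨ ≐-cross p≐ q≐ p≡q ⟩
      2 ^ (i ℕ.+ ℕ.suc r) ℤ.* v ℤ.* d
        ≡⟨ cong (λ t → t ℤ.* v ℤ.* d) (ℤ.^-distribˡ-+-* 2 i (ℕ.suc r)) ⟩
      2 ^ i ℤ.* 2 ^ ℕ.suc r ℤ.* v ℤ.* d     ≡⟨ regroup (2 ^ i) (2 ^ r) v d ⟩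
      2 ^ i ℤ.* (2 ℤ.* (2 ^ r ℤ.* v ℤ.* d)) ∎)

  Val₂-square-sub-one : ∀ {x n d i j} → x ≐ n ÷ d → Odd d →
    Val₂ℤ (n ℤ.+ d) i → Val₂ℤ (n ℤ.- d) j → Val₂ (x * x - 1ℚ) (i ℕ.+ j)
  Val₂-square-sub-one {n = n} {d} {i} {j} x≐ d-odd (val₂ℤ {u} u-odd n+d≡) (val₂ℤ {v} v-odd n-d≡) =
    val₂ (odd*odd v-odd u-odd) (odd*odd d-odd d-odd)
      (cleared (trans (clear (≐-square-sub-one x≐)) (cong fromℤ (begin
        (n ℤ.- d) ℤ.* (n ℤ.+ d)       ≡⟨ cong₂ ℤ._*_ n-d≡ n+d≡ ⟩
        2 ^ j ℤ.* v ℤ.* (2 ^ i ℤ.* u) ≡⟨ regroup (2 ^ i) (2 ^ j) u v ⟩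
        2 ^ i ℤ.* 2 ^ j ℤ.* (v ℤ.* u) ≡⟨ cong (ℤ._* (v ℤ.* u)) (ℤ.^-distribˡ-+-* 2 i j) ⟨
        2 ^ (i ℕ.+ j) ℤ.* (v ℤ.* u)   ∎))))
    where
    open ≡-Reasoning
    regroup : ∀ a b u v → b ℤ.* v ℤ.* (a ℤ.* u) ≡ a ℤ.* b ℤ.* (v ℤ.* u)
    regroup = ℤ.solve-∀

  Val₂-half-diff-square-sub-one : ∀ {x y n m d e} → x ≐ n ÷ d → y ≐ m ÷ e → Odd d → Odd e →
    Val₂ℤ (n ℤ.* m ℤ.- d ℤ.* e) 2 → Val₂ (half-diff x y * half-diff x y - 1ℚ) 0
  Val₂-half-diff-square-sub-one {d = d} {e = e} x≐ y≐ d-odd e-odd (val₂ℤ {ω} ω-odd nm-de≡4ω) =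
    Val₂-square-sub-one (≐-half-diff x≐ y≐ (trans nm-de≡4ω (ℤ.*-assoc 2 2 ω))) de-odd
      (odd⇒Val₂ℤ0 (even+odd (ω , refl) de-odd)) (odd⇒Val₂ℤ0 (even-odd (ω , refl) de-odd))
    where
    de-odd : Odd (d ℤ.* e)
    de-odd = odd*odd d-odd e-odd

module EllipticCurve where

  open import Data.Integer
  open import Data.Integer.Properties
  open import Data.Integer.Tactic.RingSolver using (solve-∀)
  import Data.Nat as ℕ
  open Parity
  open PowersOfTwo

  -- y² = x³ + 18x² − 3x in weighted coordinates x = X/Z², y = Y/Z³
  cubic : ℤ → ℤ → ℤ
  cubic X Z = X * X * X + 18 * X * X * Z * Z - 3 * X * Z * Z * Z * Z

  record Point : Set where
    constructor ⟨_,_,_⟩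
    field
      X Y Z : ℤ

  OnCurve : Point → Set
  OnCurve ⟨ X , Y , Z ⟩ = Y * Y ≡ cubic X Z

  -- The tangent at (X, Y, Z) has slope λ = slope X Z / (2YZ); with Z₂ = 2YZ the chord–tangent
  -- formulas x₂ = λ² − 18 − 2x and y₂ = λ(x − x₂) − y become tangentX and the Y of double.
  slope : ℤ → ℤ → ℤ
  slope X Z = 3 * X * X + 36 * X * Z * Z - 3 * Z * Z * Z * Z

  tangentX : ℤ → ℤ → ℤ → ℤ
  tangentX X Y Z = slope X Z * slope X Z - 8 * X * Y * Y - 72 * Y * Y * Z * Z

  double : Point → Point
  double ⟨ X , Y , Z ⟩ =
    ⟨ tangentX X Y Z , slope X Z * (4 * X * Y * Y - tangentX X Y Z) - 8 * Y * Y * Y * Y , 2 * Y * Z ⟩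

  -- T stands for tangentX X Y Z; keeping it abstract keeps the normal forms small.
  doubling-identity : ∀ X Y Z T →
    let M = 3 * X * X + 36 * X * Z * Z - 3 * Z * Z * Z * Z
        Y₂ = M * (4 * X * Y * Y - T) - 8 * Y * Y * Y * Y
        Z₂ = 2 * Y * Z
    in T * T * T + 18 * T * T * Z₂ * Z₂ - 3 * T * Z₂ * Z₂ * Z₂ * Z₂ - Y₂ * Y₂
       ≡ 64 * Y * Y * Y * Y * Y * Y * (X * X * X + 18 * X * X * Z * Z - 3 * X * Z * Z * Z * Z - Y * Y)
         + (T - 4 * X * Y * Y) * (T - 4 * X * Y * Y) * (T - (M * M - 8 * X * Y * Y - 72 * Y * Y * Z * Z))
  doubling-identity = solve-∀

  combination≡0 : ∀ a b {p q} → p ≡ 0 → q ≡ 0 → a * p + b * q ≡ 0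
  combination≡0 a b refl refl = cong₂ _+_ (*-zeroʳ a) (*-zeroʳ b)

  double-on-curve : ∀ P → OnCurve P → OnCurve (double P)
  double-on-curve ⟨ X , Y , Z ⟩ on-curve = sym (i-j≡0⇒i≡j _ _
    (trans (doubling-identity X Y Z T)
           (combination≡0 (64 * Y * Y * Y * Y * Y * Y) ((T - 4 * X * Y * Y) * (T - 4 * X * Y * Y))
                          (i≡j⇒i-j≡0 (sym on-curve)) (+-inverseʳ T))))
    where
    T : ℤ
    T = tangentX X Y Z

  record Invariant (k : ℕ) (P : Point) : Set where
    constructor invariant
    open Point P
    field
      on-curve : OnCurve P
      X-odd    : Odd X
      Y-odd    : Odd Y
      {w}      : ℤ
      w-odd    : Odd w
      Z≡       : Z ≡ 2 ^ (2 ℕ.+ k) * w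

  slope-odd : ∀ {X Z} → Odd X → Even Z → Odd (slope X Z)
  slope-odd {X} {Z} X-odd Z-even =
    odd-even (odd+even (odd*odd (odd*odd (1 , refl) X-odd) X-odd) (*even (36 * X * Z) Z-even))
             (*even (3 * Z * Z * Z) Z-even)

  double-invariant : ∀ {k P} → Invariant k P → Invariant (ℕ.suc k) (double P)
  double-invariant {k} {P@(⟨ X , Y , Z ⟩)} (invariant on-curve X-odd Y-odd {w} w-odd refl) =
    invariant (double-on-curve P on-curve) X₂-odd Y₂-odd (odd*odd Y-odd w-odd)
              (regroup Y (2 ^ (2 ℕ.+ k)) w)
    where
    Z-even : Even Z
    Z-even = 2^suc*-even (1 ℕ.+ k) w
    M-odd : Odd (slope X Z)
    M-odd = slope-odd X-odd Z-even
    X₂-odd : Odd (tangentX X Y Z)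
    X₂-odd = odd-even (odd-even (odd*odd M-odd M-odd) (even* (even* (even* (4 , refl) X) Y) Y))
                      (*even (72 * Y * Y * Z) Z-even)
    Y₂-odd : Odd (slope X Z * (4 * X * Y * Y - tangentX X Y Z) - 8 * Y * Y * Y * Y)
    Y₂-odd = odd-even (odd*odd M-odd (even-odd (even* (even* (even* (2 , refl) X) Y) Y) X₂-odd))
                      (even* (even* (even* (even* (4 , refl) Y) Y) Y) Y)
    regroup : ∀ Y P w → 2 * Y * (P * w) ≡ 2 * P * (Y * w)
    regroup = solve-∀

  point : ℕ → Point
  point ℕ.zero    = ⟨ 2401 , - 232799 , - 20 ⟩
  point (ℕ.suc k) = double (point k)

  point-invariant : ∀ k → Invariant k (point k)
  point-invariant ℕ.zero    = invariant refl (1200 , refl) (- 116400 , refl) (- 3 , refl) refl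
  point-invariant (ℕ.suc k) = double-invariant (point-invariant k)

module QuarticMap where

  open import Data.Integer
  open import Data.Integer.Properties
  open import Data.Integer.Tactic.RingSolver using (solve-∀)
  import Data.Nat as ℕ
  open Parity
  open PowersOfTwo
  open EllipticCurve

  -- x = xNum/xDen, y = yNum/yDen sends the cubic to the quartic of SevenSquares.OnQuartic.
  xNum xDen yNum yDen : Point → ℤ
  xNum ⟨ X , Y , Z ⟩ = X * X - 2 * Y * Z + 3 * Z * Z * Z * Z
  xDen ⟨ X , Y , Z ⟩ = X * X + 6 * X * Z * Z - 3 * Z * Z * Z * Z
  yNum ⟨ X , Y , Z ⟩ = - 3 * X * X - 9 * Z * Z * Z * Z + 26 * Y * Z
  yDen ⟨ X , Y , Z ⟩ = X * X - 90 * X * Z * Z - 3 * Z * Z * Z * Z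

  -- 3x²y² − 2xy − 4x² − 4y² + 7 at x = n/d, y = m/e, times d²e²
  quartic : ℤ → ℤ → ℤ → ℤ → ℤ
  quartic n m d e =
    3 * n * n * m * m - 2 * n * m * d * e - 4 * n * n * e * e - 4 * m * m * d * d + 7 * d * d * e * e

  quartic-identity : ∀ X Y Z →
    let n = X * X - 2 * Y * Z + 3 * Z * Z * Z * Z
        d = X * X + 6 * X * Z * Z - 3 * Z * Z * Z * Z
        m = - 3 * X * X - 9 * Z * Z * Z * Z + 26 * Y * Z
        e = X * X - 90 * X * Z * Z - 3 * Z * Z * Z * Z
    in 3 * n * n * m * m - 2 * n * m * d * e - 4 * n * n * e * e - 4 * m * m * d * d + 7 * d * d * e * e
       ≡ (Y * Y - (X * X * X + 18 * X * X * Z * Z - 3 * X * Z * Z * Z * Z)) *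
         (12528 * Z * Z * Z * Z * Z * Z * Z * Z * Z * Z - 29952 * Y * Z * Z * Z * Z * Z * Z * Z
          + 8112 * Y * Y * Z * Z * Z * Z + 90576 * X * Z * Z * Z * Z * Z * Z * Z * Z
          - 97344 * X * X * Z * Z * Z * Z * Z * Z - 9984 * X * X * Y * Z * Z * Z
          - 30192 * X * X * X * Z * Z * Z * Z + 1392 * X * X * X * X * Z * Z)
  quartic-identity = solve-∀

  on-curve⇒quartic≡0 : ∀ P → OnCurve P → quartic (xNum P) (yNum P) (xDen P) (yDen P) ≡ 0
  on-curve⇒quartic≡0 ⟨ X , Y , Z ⟩ on-curve =
    trans (quartic-identity X Y Z) (factor≡0 (i≡j⇒i-j≡0 on-curve))
    where
    factor≡0 : ∀ {p q} → p ≡ 0 → p * q ≡ 0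
    factor≡0 {q = q} refl = *-zeroˡ q

  -- Z is written 2 * (2 * Q) * w: for Q = 2 ^ k this is 2 ^ (2 + k) * w by definition.
  xNum-xDen-identity : ∀ X Y Q w → let Z = 2 * (2 * Q) * w in
    (X * X - 2 * Y * Z + 3 * Z * Z * Z * Z) - (X * X + 6 * X * Z * Z - 3 * Z * Z * Z * Z)
      ≡ 2 * (2 * (2 * Q)) * - (w * (Y + Z * (3 * X - 3 * Z * Z)))
  xNum-xDen-identity = solve-∀

  xNum+xDen-identity : ∀ X Y Z →
    (X * X - 2 * Y * Z + 3 * Z * Z * Z * Z) + (X * X + 6 * X * Z * Z - 3 * Z * Z * Z * Z)
      ≡ 2 * 1 * (X * X + Z * (3 * X * Z - Y))
  xNum+xDen-identity = solve-∀

  yNum-yDen-identity : ∀ X Y Q w → let Z = 2 * (2 * Q) * w; s = Q * w in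
    (- 3 * X * X - 9 * Z * Z * Z * Z + 26 * Y * Z) - (X * X - 90 * X * Z * Z - 3 * Z * Z * Z * Z)
      ≡ 2 * (2 * 1) * (2 * (13 * Y * s + 180 * X * s * s - 192 * s * s * s * s) - X * X)
  yNum-yDen-identity = solve-∀

  yNum+yDen-identity : ∀ X Y Z →
    (- 3 * X * X - 9 * Z * Z * Z * Z + 26 * Y * Z) + (X * X - 90 * X * Z * Z - 3 * Z * Z * Z * Z)
      ≡ 2 * 1 * (Z * (13 * Y - 45 * X * Z - 6 * Z * Z * Z) - X * X)
  yNum+yDen-identity = solve-∀

  module InvariantPoint {k : ℕ} {X Y w : ℤ} (X-odd : Odd X) (Y-odd : Odd Y) (w-odd : Odd w) where

    Z : ℤ
    Z = 2 ^ (2 ℕ.+ k) * w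

    P : Point
    P = ⟨ X , Y , Z ⟩

    private
      Z-even : Even Z
      Z-even = 2^suc*-even (1 ℕ.+ k) w
      X²-odd : Odd (X * X)
      X²-odd = odd*odd X-odd X-odd

    xDen-odd : Odd (xDen P)
    xDen-odd = odd-even (odd+even X²-odd (*even (6 * X * Z) Z-even)) (*even (3 * Z * Z * Z) Z-even)

    yDen-odd : Odd (yDen P)
    yDen-odd = odd-even (odd-even X²-odd (*even (90 * X * Z) Z-even)) (*even (3 * Z * Z * Z) Z-even)

    xNum+xDen-val : Val₂ℤ (xNum P + xDen P) 1
    xNum+xDen-val = val₂ℤ {u = X * X + Z * (3 * X * Z - Y)}
      (odd+even X²-odd (even* Z-even _)) (xNum+xDen-identity X Y Z)

    xNum-xDen-val : Val₂ℤ (xNum P - xDen P) (3 ℕ.+ k)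
    xNum-xDen-val = val₂ℤ {u = - (w * (Y + Z * (3 * X - 3 * Z * Z)))}
      (-odd (odd*odd w-odd (odd+even Y-odd (even* Z-even _)))) (xNum-xDen-identity X Y (2 ^ k) w)

    yNum+yDen-val : Val₂ℤ (yNum P + yDen P) 1
    yNum+yDen-val = val₂ℤ {u = Z * (13 * Y - 45 * X * Z - 6 * Z * Z * Z) - X * X}
      (even-odd (even* Z-even _) X²-odd) (yNum+yDen-identity X Y Z)

    yNum-yDen-val : Val₂ℤ (yNum P - yDen P) 2
    yNum-yDen-val = val₂ℤ {u = 2 * t - X * X} (even-odd (t , refl) X²-odd) (yNum-yDen-identity X Y (2 ^ k) w)
      where
      s t : ℤ
      s = 2 ^ k * w
      t = 13 * Y * s + 180 * X * s * s - 192 * s * s * s * s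

    xNum*yNum-xDen*yDen-val : Val₂ℤ (xNum P * yNum P - xDen P * yDen P) 2
    xNum*yNum-xDen*yDen-val =
      Val₂ℤ-*-sub {xNum P} {xDen P} {yNum P} {yDen P} {k} xNum-xDen-val yNum-yDen-val xDen-odd

module Triples where

  open import Data.Integer as ℤ using (ℤ)
  import Data.Integer.Tactic.RingSolver as ℤ
  import Data.Nat as ℕ
  open import Data.Rational
  open import Data.Rational.Properties
  open Parity
  open PowersOfTwo
  open Fractions
  open TwoAdicValuation
  open SevenSquares
  open EllipticCurve
  open QuarticMap

  quarticℚ : ℚ → ℚ → ℚ → ℚ → ℚ
  quarticℚ n m d e =
    3 * n * n * m * m - 2 * n * m * d * e - 4 * n * n * e * e - 4 * m * m * d * d + 7 * d * d * e * e

  fromℤ-quartic : ∀ n m d e →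
    fromℤ (quartic n m d e) ≡ quarticℚ (fromℤ n) (fromℤ m) (fromℤ d) (fromℤ e)
  fromℤ-quartic n m d e =
    trans (fromℤ-+ (A ℤ.- B ℤ.- C ℤ.- D) E) (cong₂ _+_
      (trans (fromℤ-- (A ℤ.- B ℤ.- C) D) (cong₂ _-_
        (trans (fromℤ-- (A ℤ.- B) C) (cong₂ _-_
          (trans (fromℤ-- A B) (cong₂ _-_ (fromℤ-monomial 3 n n m m) (fromℤ-monomial 2 n m d e)))
          (fromℤ-monomial 4 n n e e)))
        (fromℤ-monomial 4 m m d d)))
      (fromℤ-monomial 7 d d e e))
    where
    A B C D E : ℤ
    A = 3 ℤ.* n ℤ.* n ℤ.* m ℤ.* m
    B = 2 ℤ.* n ℤ.* m ℤ.* d ℤ.* e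
    C = 4 ℤ.* n ℤ.* n ℤ.* e ℤ.* e
    D = 4 ℤ.* m ℤ.* m ℤ.* d ℤ.* d
    E = 7 ℤ.* d ℤ.* d ℤ.* e ℤ.* e

  clear-denominators : ∀ x y d e →
    let r = ½ * (x * y + 1ℚ); K = 4 * d * d * e * e; n = x * d; m = y * e
    in ((x * x - 1ℚ) * (y * y - 1ℚ) + 1ℚ) * K
       ≡ r * r * K + (3 * n * n * m * m - 2 * n * m * d * e - 4 * n * n * e * e
                      - 4 * m * m * d * d + 7 * d * d * e * e)
  clear-denominators = RingSolver.solve-∀ ℚ-ring

  quartic≡0⇒OnQuartic : ∀ {x y n m d e} → x ≐ n ÷ d → y ≐ m ÷ e → Odd d → Odd e →
    quartic n m d e ≡ 0 → OnQuartic x y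
  quartic≡0⇒OnQuartic {x} {y} {n} {m} {d} {e} (cleared x≐) (cleared y≐) d-odd e-odd quartic≡0 =
    *-cancelʳ-≡ _ _ K K≢0 (begin
      ((x * x - 1ℚ) * (y * y - 1ℚ) + 1ℚ) * K ≡⟨ clear-denominators x y (fromℤ d) (fromℤ e) ⟩
      r² * K + quarticℚ (x * fromℤ d) (y * fromℤ e) (fromℤ d) (fromℤ e)
        ≡⟨ cong₂ (λ p q → r² * K + quarticℚ p q (fromℤ d) (fromℤ e)) x≐ y≐ ⟩
      r² * K + quarticℚ (fromℤ n) (fromℤ m) (fromℤ d) (fromℤ e)
        ≡⟨ cong (r² * K +_) (trans (sym (fromℤ-quartic n m d e)) (cong fromℤ quartic≡0)) ⟩
      r² * K + 0ℚ                            ≡⟨ +-identityʳ (r² * K) ⟩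
      r² * K                                 ∎)
    where
    open ≡-Reasoning
    r² K : ℚ
    r² = half-sum x y * half-sum x y
    K = 4 * fromℤ d * fromℤ d * fromℤ e * fromℤ e
    regroup : ∀ d e → 2 ℤ.^ 2 ℤ.* (d ℤ.* d ℤ.* e ℤ.* e) ≡ 4 ℤ.* d ℤ.* d ℤ.* e ℤ.* e
    regroup = ℤ.solve-∀
    K≢0 : K ≢ 0ℚ
    K≢0 K≡0 = 2^j*odd≢0 2 (odd*odd (odd*odd (odd*odd d-odd d-odd) e-odd) e-odd)
      (trans (regroup d e) (fromℤ-injective (trans (fromℤ-monomial 4 d d e e) K≡0)))

  good-triple : ∀ x y {k} → OnQuartic x y →
    Val₂ (x * x - 1ℚ) (4 ℕ.+ k) → Val₂ (y * y - 1ℚ) 3 →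
    Val₂ (half-diff x y * half-diff x y - 1ℚ) 0 →
    GoodTriple (x * x - 1ℚ) (y * y - 1ℚ) (half-diff x y * half-diff x y - 1ℚ)
  good-triple x y on-quartic a-val b-val c-val =
    ≢-sym (Val₂-≢ b-val a-val) , ≢-sym (Val₂-≢ c-val a-val) , ≢-sym (Val₂-≢ c-val b-val) ,
    Val₂⇒≢0 a-val , Val₂⇒≢0 b-val , Val₂⇒≢0 c-val ,
    seven-squares x y on-quartic

  invariant⇒good-triple : ∀ {k P} → Invariant k P →
    ∃[ a ] ∃[ b ] ∃[ c ] GoodTriple a b c × Val₂ a (4 ℕ.+ k)
  invariant⇒good-triple {k} {⟨ X , Y , _ ⟩} (invariant on-curve X-odd Y-odd {w} w-odd refl) =
    x * x - 1ℚ , y * y - 1ℚ , half-diff x y * half-diff x y - 1ℚ ,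
    good-triple x y on-quartic a-val b-val c-val , a-val
    where
    open InvariantPoint {k} {X} {Y} {w} X-odd Y-odd w-odd
    x y : ℚ
    x = proj₁ (∃-fraction (xNum P) (odd≢0 xDen-odd))
    y = proj₁ (∃-fraction (yNum P) (odd≢0 yDen-odd))
    x≐ : x ≐ xNum P ÷ xDen P
    x≐ = proj₂ (∃-fraction (xNum P) (odd≢0 xDen-odd))
    y≐ : y ≐ yNum P ÷ yDen P
    y≐ = proj₂ (∃-fraction (yNum P) (odd≢0 yDen-odd))
    on-quartic : OnQuartic x y
    on-quartic = quartic≡0⇒OnQuartic x≐ y≐ xDen-odd yDen-odd (on-curve⇒quartic≡0 P on-curve)
    a-val : Val₂ (x * x - 1ℚ) (4 ℕ.+ k)
    a-val = Val₂-square-sub-one x≐ xDen-odd xNum+xDen-val xNum-xDen-val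
    b-val : Val₂ (y * y - 1ℚ) 3
    b-val = Val₂-square-sub-one y≐ yDen-odd yNum+yDen-val yNum-yDen-val
    c-val : Val₂ (half-diff x y * half-diff x y - 1ℚ) 0
    c-val = Val₂-half-diff-square-sub-one x≐ y≐ xDen-odd yDen-odd xNum*yNum-xDen*yDen-val

module Freshness where

  open import Data.Nat
  open import Data.Nat.Properties
  open import Data.Integer using (∣_∣)
  open import Data.Rational using (↥_)
  open import Data.List using (foldr)
  open import Data.List.Membership.Propositional using (_∈_)
  open import Data.List.Relation.Unary.All using ([]; _∷_)
  open import Data.List.Relation.Unary.Any using (here; there)
  open TwoAdicValuation

  maxNumerator : List ℚ → ℕ
  maxNumerator = foldr (λ q n → ∣ ↥ q ∣ ⊔ n) 0

  ∈⇒∣↥∣≤maxNumerator : ∀ {q qs} → q ∈ qs → ∣ ↥ q ∣ ≤ maxNumerator qs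
  ∈⇒∣↥∣≤maxNumerator (here refl)  = m≤m⊔n _ _
  ∈⇒∣↥∣≤maxNumerator (there q∈qs) = ≤-trans (∈⇒∣↥∣≤maxNumerator q∈qs) (m≤n⊔m _ _)

  maxNumeratorOfTriples : List Triple → ℕ
  maxNumeratorOfTriples = foldr (λ t n → maxNumerator (elems t) ⊔ n) 0

  fresh : ∀ {a b c} L → maxNumeratorOfTriples L < ∣ ↥ a ∣ →
    All (λ t → ¬ SameSet (a , b , c) t) L
  fresh []      _       = []
  fresh (t ∷ L) bound<a = a∉t ∷ fresh L (≤-<-trans (m≤n⊔m _ _) bound<a)
    where
    a∉t : ¬ SameSet _ t
    a∉t ((a∈t ∷ _) , _) = <⇒≱ bound<a (≤-trans (∈⇒∣↥∣≤maxNumerator a∈t) (m≤m⊔n _ _))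

  n<2^n : ∀ n → n < 2 ^ n
  n<2^n zero    = z<s
  n<2^n (suc n) = ≤-<-trans (n<2^n n) (m<m+n (2 ^ n) (≤-trans (m^n>0 2 n) (m≤m+n (2 ^ n) 0)))

  Val₂-fresh : ∀ {a b c} L → Val₂ a (4 + maxNumeratorOfTriples L) →
    All (λ t → ¬ SameSet (a , b , c) t) L
  Val₂-fresh L a-val =
    fresh L (≤-<-trans (m≤n+m _ 4) (<-≤-trans (n<2^n _) (Val₂⇒2^j≤∣↥∣ a-val)))

open EllipticCurve using (point-invariant)
open Triples using (invariant⇒good-triple)
open Freshness using (maxNumeratorOfTriples; Val₂-fresh)

theorem1 : (L : List Triple) →
    ∃[ a ] ∃[ b ] ∃[ c ] (GoodTriple a b c × All (λ t → ¬ SameSet (a , b , c) t) L)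
theorem1 L with invariant⇒good-triple (point-invariant (maxNumeratorOfTriples L))
... | a , b , c , abc-good , a-val = a , b , c , abc-good , Val₂-fresh L a-val
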